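{- Let $\mathbf{XD}$ be one of the logics $\mathbf{E}\oplus N\oplus D^\bot$, $\mathbf{E}\oplus N\oplus D^\bot\oplus D^\Diamond$, $\mathbf{E}\oplus M\oplus N\oplus D^\bot$, $\mathbf{E}\oplus M\oplus N\oplus D^\bot\oplus D^\Diamond$, $\mathbf{E}\oplus M\oplus C\oplus N\oplus D^\bot\oplus D^\Diamond$. If $A\supset B$ is a theorem of $\mathbf{XD}$ and $A$ and $B$ share no propositional variable, then either $\neg A$ or $B$ is a theorem of $\mathbf{XD}$.
   Context: Formulas are generated from countably many propositional variables $p_0,p_1,\dots$ and the $0$-ary constant $\bot$ by the binary connectives $\wedge,\vee,\supset$ and the unary operator $\Box$; $\neg A:=A\supset\bot$, $\top:=\bot\supset\bot$, $A\leftrightarrow B:=(A\supset B)\wedge(B\supset A)$, $\Diamond A:=\neg\Box\neg A$. Axiomatic systems: $\mathbf{L}$ has as axioms all instances (in this language) of propositional tautologies and modus ponens as its rule; $\mathbf{E}$ is $\mathbf{L}$ plus the rule $RE$: from $A\leftrightarrow B$ infer $\Box A\leftrightarrow\Box B$. Axiom schemes: $M$: $\Box(A\wedge B)\supset(\Box A\wedge\Box B)$; $C$: $(\Box A\wedge\Box B)\supset\Box(A\wedge B)$; $N$: $\Box\top$; $D^\bot$: $\neg\Box\bot$; $D^\Diamond$: $\Box A\supset\Diamond A$. $\mathbf{E}\oplus S_1\oplus\dots\oplus S_k$ denotes the extension of $\mathbf{E}$ by all instances of the schemes $S_1,\dots,S_k$ as axioms (closed under modus ponens and $RE$). -}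

module Defs where

open import Data.Nat using (ℕ)
open import Data.Bool using (Bool; true; false; _∧_; _∨_; not)
open import Data.Product using (_×_; ∃-syntax)
open import Relation.Binary.PropositionalEquality using (_≡_)
open import Relation.Nullary using (¬_)

data Fm : Set where
  var  : ℕ → Fm
  ⊥'   : Fm
  _∧'_ : Fm → Fm → Fm
  _∨'_ : Fm → Fm → Fm
  _⊃_  : Fm → Fm → Fm
  □_   : Fm → Fm

infixr 6 _∧'_
infixr 5 _∨'_
infixr 4 _⊃_
infix 9 □_
infix 9 ◇_
infix 3 _↔_

¬' : Fm → Fm
¬' A = A ⊃ ⊥'

⊤' : Fm
⊤' = ⊥' ⊃ ⊥'

_↔_ : Fm → Fm → Fm
A ↔ B = (A ⊃ B) ∧' (B ⊃ A)

◇_ : Fm → Fm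
◇ A = ¬' (□ (¬' A))

_⇒b_ : Bool → Bool → Bool
a ⇒b b = not a ∨ b

eval : (ℕ → Bool) → (Fm → Bool) → Fm → Bool
eval v w (var n)  = v n
eval v w ⊥'       = false
eval v w (A ∧' B) = eval v w A ∧ eval v w B
eval v w (A ∨' B) = eval v w A ∨ eval v w B
eval v w (A ⊃ B)  = eval v w A ⇒b eval v w B
eval v w (□ A)    = w A

-- A is an instance of a propositional tautology iff it is true under every
-- Boolean valuation of its propositional variables and its boxed subformulas
-- (its maximal non-truth-functional components).
Taut : Fm → Set
Taut A = ∀ (v : ℕ → Bool) (w : Fm → Bool) → eval v w A ≡ true

data Scheme : Set where
  M C N Dbot Ddia : Scheme

data Inst : Scheme → Fm → Set where
  instM    : ∀ A B → Inst M (□ (A ∧' B) ⊃ (□ A ∧' □ B))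
  instC    : ∀ A B → Inst C ((□ A ∧' □ B) ⊃ □ (A ∧' B))
  instN    : Inst N (□ ⊤')
  instDbot : Inst Dbot (¬' (□ ⊥'))
  instDdia : ∀ A → Inst Ddia (□ A ⊃ ◇ A)

data XD : Set where
  END END◇ EMND EMND◇ EMCND◇ : XD

data Has : XD → Scheme → Set where
  h1N : Has END N
  h1D : Has END Dbot
  h2N : Has END◇ N
  h2D : Has END◇ Dbot
  h2◇ : Has END◇ Ddia
  h3M : Has EMND M
  h3N : Has EMND N
  h3D : Has EMND Dbot
  h4M : Has EMND◇ M
  h4N : Has EMND◇ N
  h4D : Has EMND◇ Dbot
  h4◇ : Has EMND◇ Ddia
  h5M : Has EMCND◇ M
  h5C : Has EMCND◇ C
  h5N : Has EMCND◇ N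
  h5D : Has EMCND◇ Dbot
  h5◇ : Has EMCND◇ Ddia

data _⊢_ (X : XD) : Fm → Set where
  taut : ∀ {A} → Taut A → X ⊢ A
  ax   : ∀ {S A} → Has X S → Inst S A → X ⊢ A
  mp   : ∀ {A B} → X ⊢ (A ⊃ B) → X ⊢ A → X ⊢ B
  re   : ∀ {A B} → X ⊢ (A ↔ B) → X ⊢ (□ A ↔ □ B)

infix 2 _⊢_

data Occurs (n : ℕ) : Fm → Set where
  ovar : Occurs n (var n)
  o∧l  : ∀ {A B} → Occurs n A → Occurs n (A ∧' B)
  o∧r  : ∀ {A B} → Occurs n B → Occurs n (A ∧' B)
  o∨l  : ∀ {A B} → Occurs n A → Occurs n (A ∨' B)
  o∨r  : ∀ {A B} → Occurs n B → Occurs n (A ∨' B)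
  o⊃l  : ∀ {A B} → Occurs n A → Occurs n (A ⊃ B)
  o⊃r  : ∀ {A B} → Occurs n B → Occurs n (A ⊃ B)
  o□   : ∀ {A} → Occurs n A → Occurs n (□ A)

NoSharedVar : Fm → Fm → Set
NoSharedVar A B = ¬ (∃[ n ] (Occurs n A × Occurs n B))

module Submission where

-- The proof is constructive and semantic.
-- Each logic is presented by a RuleSystem: "rules" T ▹ Y, meaning that
-- ⋀□T ⊃ □Y is a theorem, and "bad" sets T, meaning that ¬⋀□T is, whose
-- defining theorems have smaller modal depth.  By induction on the depth:
-- (1) theoremhood is decidable (decideStep, oracle): K is a theorem iff it
-- follows tautologically from the rule and bad instances over its box
-- arguments, and otherwise a Boolean countermodel refutes K in the canonical
-- interpretation "□F holds iff some T ⊆ Tr rules F", under which X is sound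
-- when formulas are read with double negations (Sat);
-- (2) the Halldén property (glue, hallden): countermodels of ¬A and of B,
-- which share no variable, combine into one refuting A ⊃ B, the induction
-- hypothesis splitting every rule across the two halves.  Rules have single
-- premises in the logics without C and arbitrary conjunctive premise sets
-- in E ⊕ M ⊕ C ⊕ N ⊕ D⊥ ⊕ D◇; corollary2 instantiates the framework.

open import Defs
open import Data.Bool using (Bool; true; false; _∧_; _∨_; if_then_else_)
open import Data.Bool.Properties using () renaming (_≟_ to _≟ᵇ_)
open import Data.Empty using (⊥; ⊥-elim)
open import Data.List using (List; []; _∷_; _++_; [_]; map; foldr; concatMap; filter; cartesianProductWith)
open import Data.List.Membership.Propositional using (_∈_; find; lose)
open import Data.List.Membership.Propositional.Properties using (∈-++⁺ˡ; ∈-++⁺ʳ; ∈-++⁻; ∈-map⁺; ∈-map⁻; ∈-concatMap⁺; ∈-concatMap⁻; ∈-filter⁺; ∈-filter⁻; ∈-cartesianProductWith⁺; ∈-cartesianProductWith⁻)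
open import Data.List.Relation.Binary.Subset.Propositional using (_⊆_)
open import Data.List.Relation.Binary.Subset.Propositional.Properties using (filter-⊆; xs⊆xs++ys; xs⊆ys++xs; ∈-∷⁺ʳ)
open import Data.List.Relation.Unary.Any using (here; there)
open import Data.Nat as ℕ using (ℕ; zero; suc; _⊔_; _<_; _≤_; z≤n; s≤s; _≤?_)
open import Data.Nat.Properties using (⊔-lub; m⊔n≤o⇒m≤o; m⊔n≤o⇒n≤o; m≤m⊔n; m≤n⊔m)
open import Data.Product using (_×_; _,_; proj₁; proj₂; ∃-syntax; uncurry)
open import Data.Sum using (_⊎_; inj₁; inj₂; [_,_]′) renaming (map to ⊎-map)
open import Relation.Binary.Definitions using (DecidableEquality)
open import Relation.Unary using (Decidable)
open import Relation.Binary.PropositionalEquality using (_≡_; refl; sym; trans; cong; cong₂)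
open import Relation.Nullary using (¬_; Dec; yes; no; does)
open import Relation.Nullary.Decidable using (map′; _×-dec_; _⊎-dec_)
open import Function using (_∘_)

_≟F_ : DecidableEquality Fm
var n ≟F var m = map′ (cong var) (λ { refl → refl }) (n ℕ.≟ m)
⊥' ≟F ⊥' = yes refl
(A ∧' B) ≟F (A' ∧' B') = map′ (uncurry (cong₂ _∧'_)) (λ { refl → refl , refl }) (A ≟F A' ×-dec B ≟F B')
(A ∨' B) ≟F (A' ∨' B') = map′ (uncurry (cong₂ _∨'_)) (λ { refl → refl , refl }) (A ≟F A' ×-dec B ≟F B')
(A ⊃ B) ≟F (A' ⊃ B') = map′ (uncurry (cong₂ _⊃_)) (λ { refl → refl , refl }) (A ≟F A' ×-dec B ≟F B')
(□ A) ≟F (□ A') = map′ (cong □_) (λ { refl → refl }) (A ≟F A')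
var _ ≟F ⊥' = no λ ()
var _ ≟F (_ ∧' _) = no λ ()
var _ ≟F (_ ∨' _) = no λ ()
var _ ≟F (_ ⊃ _) = no λ ()
var _ ≟F (□ _) = no λ ()
⊥' ≟F var _ = no λ ()
⊥' ≟F (_ ∧' _) = no λ ()
⊥' ≟F (_ ∨' _) = no λ ()
⊥' ≟F (_ ⊃ _) = no λ ()
⊥' ≟F (□ _) = no λ ()
(_ ∧' _) ≟F var _ = no λ ()
(_ ∧' _) ≟F ⊥' = no λ ()
(_ ∧' _) ≟F (_ ∨' _) = no λ ()
(_ ∧' _) ≟F (_ ⊃ _) = no λ ()
(_ ∧' _) ≟F (□ _) = no λ ()
(_ ∨' _) ≟F var _ = no λ ()
(_ ∨' _) ≟F ⊥' = no λ ()
(_ ∨' _) ≟F (_ ∧' _) = no λ ()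
(_ ∨' _) ≟F (_ ⊃ _) = no λ ()
(_ ∨' _) ≟F (□ _) = no λ ()
(_ ⊃ _) ≟F var _ = no λ ()
(_ ⊃ _) ≟F ⊥' = no λ ()
(_ ⊃ _) ≟F (_ ∧' _) = no λ ()
(_ ⊃ _) ≟F (_ ∨' _) = no λ ()
(_ ⊃ _) ≟F (□ _) = no λ ()
(□ _) ≟F var _ = no λ ()
(□ _) ≟F ⊥' = no λ ()
(□ _) ≟F (_ ∧' _) = no λ ()
(□ _) ≟F (_ ∨' _) = no λ ()
(□ _) ≟F (_ ⊃ _) = no λ ()

open import Data.List.Membership.DecPropositional _≟F_ using (_∈?_; _∉?_)

∧-true : ∀ {a b} → a ≡ true → b ≡ true → a ∧ b ≡ true
∧-true refl refl = refl

∧-trueˡ : ∀ {a b} → a ∧ b ≡ true → a ≡ true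
∧-trueˡ {true} _ = refl

∧-trueʳ : ∀ a {b} → a ∧ b ≡ true → b ≡ true
∧-trueʳ true e = e

⇒b-mp : ∀ {a b} → a ≡ true → a ⇒b b ≡ true → b ≡ true
⇒b-mp refl e = e

true≢false : true ≡ false → ⊥
true≢false ()

true-stable : ∀ b → ¬ ¬ (b ≡ true) → b ≡ true
true-stable true _ = refl
true-stable false nn = ⊥-elim (nn λ ())

-- Deciding tautologies.  Taut quantifies over valuations of variables and of
-- boxed formulas; both are "atoms", and a single ρ : Fm → Bool valuates them.
atomEval : (Fm → Bool) → Fm → Bool
atomEval ρ = eval (λ n → ρ (var n)) (λ D → ρ (□ D))

atoms : Fm → List Fm
atoms (var n) = [ var n ]
atoms ⊥' = []
atoms (A ∧' B) = atoms A ++ atoms B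
atoms (A ∨' B) = atoms A ++ atoms B
atoms (A ⊃ B) = atoms A ++ atoms B
atoms (□ A) = [ □ A ]

AgreeOn : (Fm → Bool) → (Fm → Bool) → List Fm → Set
AgreeOn ρ ρ' L = ∀ {a} → a ∈ L → ρ a ≡ ρ' a

atomEval-atoms : ∀ ρ ρ' K → AgreeOn ρ ρ' (atoms K) → atomEval ρ K ≡ atomEval ρ' K
atomEval-atoms ρ ρ' (var x) ag = ag (here refl)
atomEval-atoms ρ ρ' ⊥' ag = refl
atomEval-atoms ρ ρ' (K ∧' L) ag = cong₂ _∧_ (atomEval-atoms ρ ρ' K (ag ∘ ∈-++⁺ˡ)) (atomEval-atoms ρ ρ' L (ag ∘ ∈-++⁺ʳ (atoms K)))
atomEval-atoms ρ ρ' (K ∨' L) ag = cong₂ _∨_ (atomEval-atoms ρ ρ' K (ag ∘ ∈-++⁺ˡ)) (atomEval-atoms ρ ρ' L (ag ∘ ∈-++⁺ʳ (atoms K)))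
atomEval-atoms ρ ρ' (K ⊃ L) ag = cong₂ _⇒b_ (atomEval-atoms ρ ρ' K (ag ∘ ∈-++⁺ˡ)) (atomEval-atoms ρ ρ' L (ag ∘ ∈-++⁺ʳ (atoms K)))
atomEval-atoms ρ ρ' (□ K) ag = ag (here refl)

update : (Fm → Bool) → Fm → Bool → Fm → Bool
update ρ a b x = if does (x ≟F a) then b else ρ x

forAll : List Fm → ((Fm → Bool) → Bool) → Bool
forAll [] f = f (λ _ → false)
forAll (a ∷ L) f = forAll L (λ ρ → f (update ρ a true)) ∧ forAll L (λ ρ → f (update ρ a false))

DependsOn : List Fm → ((Fm → Bool) → Bool) → Set
DependsOn L f = ∀ ρ ρ' → AgreeOn ρ ρ' L → f ρ ≡ f ρ'

forAll-sound : ∀ L f → DependsOn L f → forAll L f ≡ true → ∀ ρ → f ρ ≡ true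
forAll-sound [] f dep e ρ = trans (dep ρ (λ _ → false) λ ()) e
forAll-sound (a ∷ L) f dep e ρ = atValue (ρ a) refl
  where
  fixed : ∀ b → DependsOn L (λ ρ → f (update ρ a b))
  fixed b ρ₁ ρ₂ ag = dep _ _ agree
    where
    agree : AgreeOn (update ρ₁ a b) (update ρ₂ a b) (a ∷ L)
    agree {x} x∈ with x ≟F a | x∈
    ... | yes _ | _ = refl
    ... | no x≢a | here x≡a = ⊥-elim (x≢a x≡a)
    ... | no _ | there x∈L = ag x∈L
  unchanged : ∀ b → ρ a ≡ b → f (update ρ a b) ≡ f ρ
  unchanged b ρa≡b = dep _ _ λ {x} _ → same x
    where
    same : ∀ x → update ρ a b x ≡ ρ x
    same x with x ≟F a
    ... | yes refl = sym ρa≡b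
    ... | no _ = refl
  atValue : ∀ b → ρ a ≡ b → f ρ ≡ true
  atValue true eq = trans (sym (unchanged true eq)) (forAll-sound L _ (fixed true) (∧-trueˡ e) ρ)
  atValue false eq = trans (sym (unchanged false eq)) (forAll-sound L _ (fixed false) (∧-trueʳ _ e) ρ)

forAll-counterexample : ∀ L f → forAll L f ≡ false → ∃[ ρ ] f ρ ≡ false
forAll-counterexample [] f e = _ , e
forAll-counterexample (a ∷ L) f e with forAll L (λ ρ → f (update ρ a true)) in eq
... | false = let (ρ , p) = forAll-counterexample L _ eq in update ρ a true , p
... | true = let (ρ , p) = forAll-counterexample L _ e in update ρ a false , p

isTaut : Fm → Bool
isTaut K = forAll (atoms K) (λ ρ → atomEval ρ K)

isTaut-sound : ∀ K → isTaut K ≡ true → Taut K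
isTaut-sound K e v w = forAll-sound (atoms K) (λ ρ → atomEval ρ K) (λ ρ ρ' → atomEval-atoms ρ ρ' K) e atomValue
  where
  atomValue : Fm → Bool
  atomValue (var n) = v n
  atomValue (□ D) = w D
  atomValue _ = false

Refutable : Fm → Set
Refutable K = ∃[ v ] ∃[ w ] eval v w K ≡ false

taut? : ∀ K → Taut K ⊎ Refutable K
taut? K with isTaut K in eq
... | true = inj₁ (isTaut-sound K eq)
... | false = let (ρ , p) = forAll-counterexample (atoms K) _ eq in inj₂ (_ , _ , p)

substitute : (ℕ → Fm) → Fm → Fm
substitute σ (var n) = σ n
substitute σ ⊥' = ⊥'
substitute σ (A ∧' B) = substitute σ A ∧' substitute σ B
substitute σ (A ∨' B) = substitute σ A ∨' substitute σ B
substitute σ (A ⊃ B) = substitute σ A ⊃ substitute σ B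
substitute σ (□ A) = □ (substitute σ A)

eval-substitute : ∀ σ v w A →
  eval v w (substitute σ A) ≡ eval (λ n → eval v w (σ n)) (λ D → w (substitute σ D)) A
eval-substitute σ v w (var x) = refl
eval-substitute σ v w ⊥' = refl
eval-substitute σ v w (A ∧' B) = cong₂ _∧_ (eval-substitute σ v w A) (eval-substitute σ v w B)
eval-substitute σ v w (A ∨' B) = cong₂ _∨_ (eval-substitute σ v w A) (eval-substitute σ v w B)
eval-substitute σ v w (A ⊃ B) = cong₂ _⇒b_ (eval-substitute σ v w A) (eval-substitute σ v w B)
eval-substitute σ v w (□ A) = refl

taut-substitute : ∀ σ A → Taut A → Taut (substitute σ A)
taut-substitute σ A t v w = trans (eval-substitute σ v w A) (t _ _)

-- the substitution p_i ↦ i-th entry of a list (⊤ beyond its end)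
slots : List Fm → ℕ → Fm
slots [] _ = ⊤'
slots (A ∷ As) zero = A
slots (A ∷ As) (suc n) = slots As n

p₀ p₁ p₂ p₃ : Fm
p₀ = var 0
p₁ = var 1
p₂ = var 2
p₃ = var 3

⋀ : List Fm → Fm
⋀ = foldr _∧'_ ⊤'

⋀□ : List Fm → Fm
⋀□ T = ⋀ (map □_ T)

-- A rule with schema
-- P₁ ⊃ … ⊃ Pₙ ⊃ C in p₀ … p₃ whose tautologyhood is verified by evaluation
-- ('refl' for isTaut) can be applied to any substitution instance.
module Reasoning (X : XD) where

  Th : Fm → Set
  Th A = X ⊢ A

  by₀ : ∀ Z → isTaut Z ≡ true → ∀ As → Th (substitute (slots As) Z)
  by₀ Z e As = taut (taut-substitute (slots As) Z (isTaut-sound Z e))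

  by₁ : ∀ P Z → isTaut (P ⊃ Z) ≡ true → ∀ As →
    Th (substitute (slots As) P) → Th (substitute (slots As) Z)
  by₁ P Z e As x = mp (by₀ (P ⊃ Z) e As) x

  by₂ : ∀ P Q Z → isTaut (P ⊃ Q ⊃ Z) ≡ true → ∀ As →
    Th (substitute (slots As) P) → Th (substitute (slots As) Q) → Th (substitute (slots As) Z)
  by₂ P Q Z e As x y = mp (mp (by₀ (P ⊃ Q ⊃ Z) e As) x) y

  ⊤-thm : Th ⊤'
  ⊤-thm = by₀ ⊤' refl []

  ↔-sym : ∀ {A B} → Th (A ↔ B) → Th (B ↔ A)
  ↔-sym {A} {B} = by₁ (p₀ ↔ p₁) (p₁ ↔ p₀) refl (A ∷ B ∷ [])

  ↔-mp : ∀ {A B} → Th A → Th (A ↔ B) → Th B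
  ↔-mp {A} {B} = by₂ p₀ (p₀ ↔ p₁) p₁ refl (A ∷ B ∷ [])

  ⊃-trans : ∀ {A B D} → Th (A ⊃ B) → Th (B ⊃ D) → Th (A ⊃ D)
  ⊃-trans {A} {B} {D} = by₂ (p₀ ⊃ p₁) (p₁ ⊃ p₂) (p₀ ⊃ p₂) refl (A ∷ B ∷ D ∷ [])

  □-mono : Has X M → ∀ {A B} → Th (A ⊃ B) → Th (□ A ⊃ □ B)
  □-mono hM {A} {B} A⊃B =
    by₂ (p₀ ↔ p₂) (p₂ ⊃ (p₀ ∧' p₁)) (p₀ ⊃ p₁) refl (□ A ∷ □ B ∷ □ (A ∧' B) ∷ [])
      (re (by₁ (p₀ ⊃ p₁) (p₀ ↔ (p₀ ∧' p₁)) refl (A ∷ B ∷ []) A⊃B)) (ax hM (instM A B))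

  □-necessitation : Has X N → ∀ {A} → Th A → Th (□ A)
  □-necessitation hN {A} a =
    by₂ (p₀ ↔ p₁) p₁ p₀ refl (□ A ∷ □ ⊤' ∷ [])
      (re (by₁ p₀ (p₀ ↔ ⊤') refl (A ∷ []) a)) (ax hN instN)

  □-refutation : Has X Dbot → ∀ {A} → Th (¬' A) → Th (¬' (□ A))
  □-refutation hD {A} ¬a =
    by₂ (p₀ ↔ p₁) (¬' p₁) (¬' p₀) refl (□ A ∷ □ ⊥' ∷ [])
      (re (by₁ (¬' p₀) (p₀ ↔ ⊥') refl (A ∷ []) ¬a)) (ax hD instDbot)

-- Disjunction is read as ¬¬(_ ⊎ _), so all connectives preserve
-- ¬¬-stability and every tautology holds whenever W is ¬¬-stable.
Sat : (ℕ → Bool) → (Fm → Set) → Fm → Set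
Sat v W (var n) = v n ≡ true
Sat v W ⊥' = ⊥
Sat v W (A ∧' B) = Sat v W A × Sat v W B
Sat v W (A ∨' B) = ¬ ¬ (Sat v W A ⊎ Sat v W B)
Sat v W (A ⊃ B) = Sat v W A → Sat v W B
Sat v W (□ A) = W A

Stable : (Fm → Set) → Set
Stable W = ∀ A → ¬ ¬ W A → W A

Sat-stable : ∀ {W} v → Stable W → ∀ A → ¬ ¬ Sat v W A → Sat v W A
Sat-stable v st (var n) nn = true-stable (v n) nn
Sat-stable v st ⊥' nn = nn λ x → x
Sat-stable v st (A ∧' B) nn = Sat-stable v st A (λ k → nn (k ∘ proj₁)) , Sat-stable v st B (λ k → nn (k ∘ proj₂))
Sat-stable v st (A ∨' B) nn = λ k → nn λ p → p k
Sat-stable v st (A ⊃ B) nn = λ a → Sat-stable v st B λ k → nn λ f → k (f a)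
Sat-stable v st (□ A) nn = st A nn

boxArgs : Fm → List Fm
boxArgs (var n) = []
boxArgs ⊥' = []
boxArgs (A ∧' B) = boxArgs A ++ boxArgs B
boxArgs (A ∨' B) = boxArgs A ++ boxArgs B
boxArgs (A ⊃ B) = boxArgs A ++ boxArgs B
boxArgs (□ A) = [ A ]

Agrees : (Fm → Set) → (Fm → Bool) → List Fm → Set
Agrees W w L = ∀ {F} → F ∈ L → (W F → w F ≡ true) × (w F ≡ true → W F)

Sat⇔eval : ∀ {W w} v → Stable W → ∀ A → Agrees W w (boxArgs A) →
  (Sat v W A → eval v w A ≡ true) × (eval v w A ≡ true → Sat v W A)
Sat⇔eval v st (var n) ag = (λ x → x) , (λ x → x)
Sat⇔eval v st ⊥' ag = (λ ()) , (λ ())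
Sat⇔eval {W} {w} v st (A ∧' B) ag =
  (λ (a , b) → ∧-true (proj₁ IA a) (proj₁ IB b)) ,
  (λ e → proj₂ IA (∧-trueˡ e) , proj₂ IB (∧-trueʳ (eval v w A) e))
  where
  IA = Sat⇔eval v st A (ag ∘ ∈-++⁺ˡ)
  IB = Sat⇔eval v st B (ag ∘ ∈-++⁺ʳ (boxArgs A))
Sat⇔eval {W} {w} v st (A ∨' B) ag = to , from
  where
  IA = Sat⇔eval v st A (ag ∘ ∈-++⁺ˡ)
  IB = Sat⇔eval v st B (ag ∘ ∈-++⁺ʳ (boxArgs A))
  to : Sat v W (A ∨' B) → eval v w (A ∨' B) ≡ true
  to nn with eval v w A in eqA
  ... | true = refl
  ... | false = true-stable _ λ k → nn λ { (inj₁ a) → true≢false (trans (sym (proj₁ IA a)) eqA) ; (inj₂ b) → k (proj₁ IB b) }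
  from : eval v w (A ∨' B) ≡ true → Sat v W (A ∨' B)
  from e k with eval v w A in eqA
  ... | true = k (inj₁ (proj₂ IA eqA))
  ... | false = k (inj₂ (proj₂ IB e))
Sat⇔eval {W} {w} v st (A ⊃ B) ag = to , from
  where
  IA = Sat⇔eval v st A (ag ∘ ∈-++⁺ˡ)
  IB = Sat⇔eval v st B (ag ∘ ∈-++⁺ʳ (boxArgs A))
  to : Sat v W (A ⊃ B) → eval v w (A ⊃ B) ≡ true
  to h with eval v w A in eqA
  ... | false = refl
  ... | true = proj₁ IB (h (proj₂ IA eqA))
  from : eval v w (A ⊃ B) ≡ true → Sat v W (A ⊃ B)
  from e a with eval v w A in eqA
  ... | true = proj₂ IB e
  ... | false = ⊥-elim (true≢false (trans (sym (proj₁ IA a)) eqA))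
Sat⇔eval v st (□ D) ag = ag (here refl)

decidingValuation : ∀ W L → ¬ ¬ (∃[ w ] Agrees W w L)
decidingValuation W [] k = k ((λ _ → false) , λ ())
decidingValuation W (F ∷ L) k =
  decidingValuation W L λ (w , ag) → excludedMiddle λ d → k (extend w ag d)
  where
  excludedMiddle : ¬ ¬ (W F ⊎ ¬ W F)
  excludedMiddle h = h (inj₂ λ x → h (inj₁ x))
  reset : ∀ {w} b → Agrees W w L → (W F → b ≡ true) × (b ≡ true → W F) → Agrees W (update w F b) (F ∷ L)
  reset {w} b ag atF {G} G∈ with G ≟F F | G∈
  ... | yes refl | _ = atF
  ... | no G≢F | here G≡F = ⊥-elim (G≢F G≡F)
  ... | no _ | there G∈L = ag G∈L
  extend : ∀ w → Agrees W w L → W F ⊎ ¬ W F → ∃[ w' ] Agrees W w' (F ∷ L)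
  extend w ag (inj₁ WF) = update w F true , reset true ag ((λ _ → refl) , (λ _ → WF))
  extend w ag (inj₂ ¬WF) = update w F false , reset false ag ((λ WF → ⊥-elim (¬WF WF)) , (λ ()))

taut-Sat : ∀ {W} A → Taut A → Stable W → ∀ v → Sat v W A
taut-Sat {W} A t st v =
  Sat-stable v st A λ k → decidingValuation W (boxArgs A) λ (w , ag) → k (proj₂ (Sat⇔eval v st A ag) (t v w))

module Soundness (X : XD) where
  open Reasoning X

  record Validates (W : Fm → Set) : Set where
    field
      congruence : ∀ {A B} → Th (A ↔ B) → W A → W B
      axioms : ∀ {S A} → Has X S → Inst S A → ∀ v → Sat v W A

  sound : ∀ {W} → Stable W → Validates W → ∀ {A} → Th A → ∀ v → Sat v W A
  sound st val (taut {A} t) v = taut-Sat A t st v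
  sound st val (ax h i) v = Validates.axioms val h i v
  sound st val (mp d e) v = sound st val d v (sound st val e v)
  sound st val (re d) v = Validates.congruence val d , Validates.congruence val (↔-sym d)

  -- Box erasure (reading □A as A) maps every theorem to a tautology, so ⊥
  -- is not a theorem.
  erase : (ℕ → Bool) → Fm → Bool
  erase v (var n) = v n
  erase v ⊥' = false
  erase v (A ∧' B) = erase v A ∧ erase v B
  erase v (A ∨' B) = erase v A ∨ erase v B
  erase v (A ⊃ B) = erase v A ⇒b erase v B
  erase v (□ A) = erase v A

  eval-erase : ∀ v A → eval v (erase v) A ≡ erase v A
  eval-erase v (var x) = refl
  eval-erase v ⊥' = refl
  eval-erase v (A ∧' B) = cong₂ _∧_ (eval-erase v A) (eval-erase v B)
  eval-erase v (A ∨' B) = cong₂ _∨_ (eval-erase v A) (eval-erase v B)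
  eval-erase v (A ⊃ B) = cong₂ _⇒b_ (eval-erase v A) (eval-erase v B)
  eval-erase v (□ A) = refl

  ⇒b-refl : ∀ a → a ⇒b a ≡ true
  ⇒b-refl true = refl
  ⇒b-refl false = refl

  ⇒b-¬¬ : ∀ a → a ⇒b ((a ⇒b false) ⇒b false) ≡ true
  ⇒b-¬¬ true = refl
  ⇒b-¬¬ false = refl

  erased : ∀ {A} → Th A → ∀ v → erase v A ≡ true
  erased (taut {A} t) v = trans (sym (eval-erase v A)) (t v (erase v))
  erased (ax h (instM A B)) v = ⇒b-refl (erase v A ∧ erase v B)
  erased (ax h (instC A B)) v = ⇒b-refl (erase v A ∧ erase v B)
  erased (ax h instN) v = refl
  erased (ax h instDbot) v = refl
  erased (ax h (instDdia A)) v = ⇒b-¬¬ (erase v A)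
  erased (mp d e) v = ⇒b-mp (erased e v) (erased d v)
  erased (re d) v = erased d v

  consistent : ¬ Th ⊥'
  consistent d with erased d (λ _ → false)
  ... | ()

depth : Fm → ℕ
depth (var n) = 0
depth ⊥' = 0
depth (A ∧' B) = depth A ⊔ depth B
depth (A ∨' B) = depth A ⊔ depth B
depth (A ⊃ B) = depth A ⊔ depth B
depth (□ A) = suc (depth A)

Bounded : ℕ → List Fm → Set
Bounded k L = ∀ {F} → F ∈ L → depth F < k

boxArgs-bounded : ∀ K {n} → depth K ≤ n → Bounded n (boxArgs K)
boxArgs-bounded (K ∧' L) {n} p q with ∈-++⁻ (boxArgs K) q
... | inj₁ r = boxArgs-bounded K (m⊔n≤o⇒m≤o (depth K) (depth L) p) r
... | inj₂ r = boxArgs-bounded L (m⊔n≤o⇒n≤o (depth K) (depth L) p) r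
boxArgs-bounded (K ∨' L) {n} p q with ∈-++⁻ (boxArgs K) q
... | inj₁ r = boxArgs-bounded K (m⊔n≤o⇒m≤o (depth K) (depth L) p) r
... | inj₂ r = boxArgs-bounded L (m⊔n≤o⇒n≤o (depth K) (depth L) p) r
boxArgs-bounded (K ⊃ L) {n} p q with ∈-++⁻ (boxArgs K) q
... | inj₁ r = boxArgs-bounded K (m⊔n≤o⇒m≤o (depth K) (depth L) p) r
... | inj₂ r = boxArgs-bounded L (m⊔n≤o⇒n≤o (depth K) (depth L) p) r
boxArgs-bounded (□ K) p (here refl) = p

Disjoint : List Fm → List Fm → Set
Disjoint L₁ L₂ = ∀ {n a b} → a ∈ L₁ → b ∈ L₂ → Occurs n a → Occurs n b → ⊥

boxArgs-occurs : ∀ K {a n} → a ∈ boxArgs K → Occurs n a → Occurs n K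
boxArgs-occurs (K ∧' L) q o with ∈-++⁻ (boxArgs K) q
... | inj₁ r = o∧l (boxArgs-occurs K r o)
... | inj₂ r = o∧r (boxArgs-occurs L r o)
boxArgs-occurs (K ∨' L) q o with ∈-++⁻ (boxArgs K) q
... | inj₁ r = o∨l (boxArgs-occurs K r o)
... | inj₂ r = o∨r (boxArgs-occurs L r o)
boxArgs-occurs (K ⊃ L) q o with ∈-++⁻ (boxArgs K) q
... | inj₁ r = o⊃l (boxArgs-occurs K r o)
... | inj₂ r = o⊃r (boxArgs-occurs L r o)
boxArgs-occurs (□ K) (here refl) o = o□ o

¬-occurs : ∀ {n A} → Occurs n (¬' A) → Occurs n A
¬-occurs (o⊃l o) = o

occurs? : ∀ n K → Dec (Occurs n K)
occurs? n (var m) = map′ (λ { refl → ovar }) (λ { ovar → refl }) (n ℕ.≟ m)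
occurs? n ⊥' = no λ ()
occurs? n (K ∧' L) = map′ [ o∧l , o∧r ]′ (λ { (o∧l o) → inj₁ o ; (o∧r o) → inj₂ o }) (occurs? n K ⊎-dec occurs? n L)
occurs? n (K ∨' L) = map′ [ o∨l , o∨r ]′ (λ { (o∨l o) → inj₁ o ; (o∨r o) → inj₂ o }) (occurs? n K ⊎-dec occurs? n L)
occurs? n (K ⊃ L) = map′ [ o⊃l , o⊃r ]′ (λ { (o⊃l o) → inj₁ o ; (o⊃r o) → inj₂ o }) (occurs? n K ⊎-dec occurs? n L)
occurs? n (□ K) = map′ o□ (λ { (o□ o) → o }) (occurs? n K)

eval-vars : ∀ v v' w K → (∀ n → Occurs n K → v n ≡ v' n) → eval v w K ≡ eval v' w K
eval-vars v v' w (var x) h = h x ovar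
eval-vars v v' w ⊥' h = refl
eval-vars v v' w (K ∧' L) h = cong₂ _∧_ (eval-vars v v' w K λ n o → h n (o∧l o)) (eval-vars v v' w L λ n o → h n (o∧r o))
eval-vars v v' w (K ∨' L) h = cong₂ _∨_ (eval-vars v v' w K λ n o → h n (o∨l o)) (eval-vars v v' w L λ n o → h n (o∨r o))
eval-vars v v' w (K ⊃ L) h = cong₂ _⇒b_ (eval-vars v v' w K λ n o → h n (o⊃l o)) (eval-vars v v' w L λ n o → h n (o⊃r o))
eval-vars v v' w (□ K) h = refl

_⇒_ : List Fm → Fm → Fm
Γ ⇒ K = foldr _⊃_ K Γ

⇒-refuted : ∀ v w Γ K → eval v w (Γ ⇒ K) ≡ false →
  (∀ {γ} → γ ∈ Γ → eval v w γ ≡ true) × eval v w K ≡ false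
⇒-refuted v w [] K e = (λ ()) , e
⇒-refuted v w (γ ∷ Γ) K e with eval v w γ in eq
... | true = (λ { (here refl) → eq ; (there q) → proj₁ (⇒-refuted v w Γ K e) q }) , proj₂ (⇒-refuted v w Γ K e)

⋀-true : ∀ v w L → (∀ {x} → x ∈ L → eval v w x ≡ true) → eval v w (⋀ L) ≡ true
⋀-true v w [] h = refl
⋀-true v w (x ∷ L) h = ∧-true (h (here refl)) (⋀-true v w L (h ∘ there))

⋀-member : ∀ v w L {x} → eval v w (⋀ L) ≡ true → x ∈ L → eval v w x ≡ true
⋀-member v w (y ∷ L) e (here refl) = ∧-trueˡ e
⋀-member v w (y ∷ L) e (there q) = ⋀-member v w L (∧-trueʳ (eval v w y) e) q

module Framework (X : XD) where
  open Reasoning X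
  open Soundness X

  record Oracle (k : ℕ) : Set where
    field
      answer : Fm → Bool
      correct : ∀ {φ} → depth φ < k → (answer φ ≡ true → Th φ) × (Th φ → answer φ ≡ true)
  open Oracle

  HalldenBelow : ℕ → Set
  HalldenBelow k = ∀ P Q → depth P < k → depth Q < k → Th (P ⊃ Q) → NoSharedVar P Q → Th (¬' P) ⊎ Th Q

  Canon : (List Fm → Fm → Set) → List Fm → Fm → Set
  Canon Rule Tr Y = ¬ ¬ (∃[ T ] (T ⊆ Tr × Rule T Y))

  Canon-stable : ∀ Rule Tr → Stable (Canon Rule Tr)
  Canon-stable Rule Tr Y nn k = nn λ c → c k

  record RuleSystem : Set₁ where
    field
      Rule : List Fm → Fm → Set
      Bad : List Fm → Set
      ruleSound : ∀ {T Y} → Rule T Y → Th (⋀□ T ⊃ □ Y)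
      badSound : ∀ {T} → Bad T → Th (¬' (⋀□ T))
      ruleRefl : ∀ t → Rule [ t ] t
      ruleB : (Fm → Bool) → List Fm → Fm → Bool
      ruleB-correct : ∀ {k} (o : Oracle k) {T Y} → Bounded k (Y ∷ T) →
        (ruleB (answer o) T Y ≡ true → Rule T Y) × (Rule T Y → ruleB (answer o) T Y ≡ true)
      badB : (Fm → Bool) → List Fm → Bool
      badB-correct : ∀ {k} (o : Oracle k) {T} → Bounded k T →
        (badB (answer o) T ≡ true → Bad T) × (Bad T → badB (answer o) T ≡ true)
      cands : List Fm → List (List Fm)
      cands-⊆ : ∀ S {T} → T ∈ cands S → T ⊆ S
      coverRule : ∀ {S Tr T Y} → Tr ⊆ S → T ⊆ Tr → Rule T Y → ∃[ T' ] (T' ∈ cands S × T' ⊆ Tr × Rule T' Y)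
      coverBad : ∀ {S Tr T} → Tr ⊆ S → T ⊆ Tr → Bad T → ∃[ T' ] (T' ∈ cands S × T' ⊆ Tr × Bad T')
      canonical : ∀ Tr → (∀ {T} → T ⊆ Tr → ¬ Bad T) → Validates (Canon Rule Tr)
      splitRule : ∀ {k} → HalldenBelow k → ∀ {TA TB Y T} → Bounded k (Y ∷ TA) → Bounded k TB →
        Disjoint (Y ∷ TA) TB → T ⊆ TA ++ TB → Rule T Y →
        (∃[ T' ] (T' ⊆ TA × Rule T' Y)) ⊎ (∃[ T' ] (T' ⊆ TB × Bad T'))
      splitBad : ∀ {k} → HalldenBelow k → ∀ {TA TB T} → Bounded k TA → Bounded k TB →
        Disjoint TA TB → T ⊆ TA ++ TB → Bad T →
        (∃[ T' ] (T' ⊆ TA × Bad T')) ⊎ (∃[ T' ] (T' ⊆ TB × Bad T'))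

  module Completeness (R : RuleSystem) where
    open RuleSystem R

    NoBad : List Fm → Set
    NoBad Tr = ∀ {T} → T ⊆ Tr → ¬ Bad T

    canonicalSound : ∀ {Tr} → NoBad Tr → ∀ {K} → Th K → ∀ v → Sat v (Canon Rule Tr) K
    canonicalSound {Tr} noBad = sound (Canon-stable Rule Tr) (canonical Tr noBad)

    canonicalAgrees : ∀ {Tr S w} → (∀ {F} → F ∈ S → w F ≡ true → F ∈ Tr) →
      (∀ {T F} → T ⊆ Tr → F ∈ S → Rule T F → w F ≡ true) → Agrees (Canon Rule Tr) w S
    canonicalAgrees incl closed {F} F∈ =
      (λ c → true-stable _ λ k → c λ (T , T⊆ , r) → k (closed T⊆ F∈ r)) ,
      (λ e k → k ([ F ] , (λ { (here refl) → incl F∈ e }) , ruleRefl F))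

    trueIn : (Fm → Bool) → List Fm → List Fm
    trueIn w = filter (λ F → w F ≟ᵇ true)

    trueIn-⊆ : ∀ w S → trueIn w S ⊆ S
    trueIn-⊆ w S = filter-⊆ (λ F → w F ≟ᵇ true) S

    trueIn-∈ : ∀ w {S F} → F ∈ S → w F ≡ true → F ∈ trueIn w S
    trueIn-∈ w = ∈-filter⁺ (λ F → w F ≟ᵇ true)

    trueIn-true : ∀ w S {F} → F ∈ trueIn w S → w F ≡ true
    trueIn-true w S F∈ = proj₂ (∈-filter⁻ (λ F → w F ≟ᵇ true) {xs = S} F∈)

    record Countermodel (K : Fm) : Set where
      field
        v : ℕ → Bool
        w : Fm → Bool
        refutes : eval v w K ≡ false
        closed : ∀ {T Y} → T ⊆ trueIn w (boxArgs K) → Y ∈ boxArgs K → Rule T Y → w Y ≡ true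
        noBad : NoBad (trueIn w (boxArgs K))

    refute : ∀ {K} → Countermodel K → ¬ Th K
    refute {K} c d = true≢false (trans (sym holds) refutes)
      where
      open Countermodel c
      holds : eval v w K ≡ true
      holds = proj₁ (Sat⇔eval v (Canon-stable Rule _) K (canonicalAgrees (trueIn-∈ w) closed)) (canonicalSound noBad d v)

    ruleHyps : (Fm → Bool) → List Fm → List Fm
    ruleHyps O S = concatMap (λ T → map (λ Y → ⋀□ T ⊃ □ Y) (filter (λ Y → ruleB O T Y ≟ᵇ true) S)) (cands S)

    badHyps : (Fm → Bool) → List Fm → List Fm
    badHyps O S = map (λ T → ¬' (⋀□ T)) (filter (λ T → badB O T ≟ᵇ true) (cands S))

    discharge : ∀ Γ K → (∀ {γ} → γ ∈ Γ → Th γ) → Th (Γ ⇒ K) → Th K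
    discharge [] K h d = d
    discharge (γ ∷ Γ) K h d = discharge Γ K (h ∘ there) (mp d (h (here refl)))

    module Hypotheses {k} (o : Oracle k) (K : Fm) (bounded : Bounded k (boxArgs K)) where
      O = answer o
      S = boxArgs K
      Γ = ruleHyps O S ++ badHyps O S

      bounded-cand : ∀ {T Y} → T ∈ cands S → Y ∈ S → Bounded k (Y ∷ T)
      bounded-cand T∈ Y∈ (here refl) = bounded Y∈
      bounded-cand T∈ Y∈ (there t∈) = bounded (cands-⊆ S T∈ t∈)

      bounded-bad : ∀ {T} → T ∈ cands S → Bounded k T
      bounded-bad T∈ t∈ = bounded (cands-⊆ S T∈ t∈)

      hyps-theorems : ∀ {γ} → γ ∈ Γ → Th γ
      hyps-theorems γ∈ with ∈-++⁻ (ruleHyps O S) γ∈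
      ... | inj₁ γ∈R with find (∈-concatMap⁻ _ {xs = cands S} γ∈R)
      ... | T , T∈ , γ∈T with ∈-map⁻ _ γ∈T
      ... | Y , Y∈' , refl with ∈-filter⁻ (λ Y → ruleB O T Y ≟ᵇ true) {xs = S} Y∈'
      ... | Y∈ , e = ruleSound (proj₁ (ruleB-correct o (bounded-cand T∈ Y∈)) e)
      hyps-theorems γ∈ | inj₂ γ∈B with ∈-map⁻ _ γ∈B
      ... | T , T∈' , refl with ∈-filter⁻ (λ T → badB O T ≟ᵇ true) {xs = cands S} T∈'
      ... | T∈ , e = badSound (proj₁ (badB-correct o (bounded-bad T∈)) e)

      rule∈hyps : ∀ {T Y} → T ∈ cands S → Y ∈ S → Rule T Y → (⋀□ T ⊃ □ Y) ∈ Γ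
      rule∈hyps T∈ Y∈ r = ∈-++⁺ˡ (∈-concatMap⁺ _ {xs = cands S} (lose T∈ (∈-map⁺ _
        (∈-filter⁺ (λ Y → ruleB O _ Y ≟ᵇ true) Y∈ (proj₂ (ruleB-correct o (bounded-cand T∈ Y∈)) r)))))

      bad∈hyps : ∀ {T} → T ∈ cands S → Bad T → ¬' (⋀□ T) ∈ Γ
      bad∈hyps T∈ b = ∈-++⁺ʳ (ruleHyps O S) (∈-map⁺ _
        (∈-filter⁺ (λ T → badB O T ≟ᵇ true) T∈ (proj₂ (badB-correct o (bounded-bad T∈)) b)))

      -- A valuation refuting Γ ⇒ K is a countermodel of K: by the covering
      -- property every rule and bad set over its true box arguments is
      -- witnessed by a candidate, i.e. by a hypothesis it satisfies.
      countermodel : ∀ v w → eval v w (Γ ⇒ K) ≡ false → Countermodel K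
      countermodel v w e = record { v = v ; w = w ; refutes = proj₂ refuted ; closed = closed ; noBad = noBad }
        where
        refuted = ⇒-refuted v w Γ K e
        premises : ∀ {T} → T ⊆ trueIn w S → eval v w (⋀□ T) ≡ true
        premises T⊆ = ⋀-true v w _ λ x∈ → let (t , t∈ , eq) = ∈-map⁻ □_ x∈ in
          trans (cong (eval v w) eq) (trueIn-true w S (T⊆ t∈))
        closed : ∀ {T Y} → T ⊆ trueIn w S → Y ∈ S → Rule T Y → w Y ≡ true
        closed T⊆ Y∈ r with coverRule (trueIn-⊆ w S) T⊆ r
        ... | T' , T'∈ , T'⊆ , r' = ⇒b-mp (premises T'⊆) (proj₁ refuted (rule∈hyps T'∈ Y∈ r'))
        noBad : NoBad (trueIn w S)
        noBad T⊆ b with coverBad (trueIn-⊆ w S) T⊆ b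
        ... | T' , T'∈ , T'⊆ , b' = true≢false (sym (⇒b-mp (premises T'⊆) (proj₁ refuted (bad∈hyps T'∈ b'))))

    decideStep : ∀ {k} → Oracle k → ∀ K → Bounded k (boxArgs K) → Th K ⊎ Countermodel K
    decideStep o K bounded = conclude (taut? (Γ ⇒ K))
      where
      open Hypotheses o K bounded
      conclude : Taut (Γ ⇒ K) ⊎ Refutable (Γ ⇒ K) → Th K ⊎ Countermodel K
      conclude (inj₁ t) = inj₁ (discharge Γ K hyps-theorems (taut t))
      conclude (inj₂ (v , w , e)) = inj₂ (countermodel v w e)

    oracle : ∀ k → Oracle k
    oracle zero = record { answer = λ _ → false ; correct = λ () }
    oracle (suc m) = record { answer = answerBelow ; correct = correctBelow }
      where
      answerBelow : Fm → Bool
      answerBelow φ with depth φ ≤? m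
      ... | no _ = false
      ... | yes φ≤m = [ (λ _ → true) , (λ _ → false) ]′ (decideStep (oracle m) φ (boxArgs-bounded φ φ≤m))
      correctBelow : ∀ {φ} → depth φ < suc m → (answerBelow φ ≡ true → Th φ) × (Th φ → answerBelow φ ≡ true)
      correctBelow {φ} (s≤s φ≤m) with depth φ ≤? m
      ... | no φ≰m = ⊥-elim (φ≰m φ≤m)
      ... | yes φ≤m' with decideStep (oracle m) φ (boxArgs-bounded φ φ≤m')
      ... | inj₁ t = (λ _ → t) , (λ _ → refl)
      ... | inj₂ c = (λ ()) , (λ t → ⊥-elim (refute c t))

    -- By splitting rules
    -- (Halldén below k), the canonical interpretation over Tr agrees with c.
    sideAgrees : ∀ {k K} (c : Countermodel K) → HalldenBelow k → ∀ {Other Tr} →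
      Bounded k (boxArgs K) → Bounded k Other → Disjoint (boxArgs K) Other → NoBad Other →
      trueIn (Countermodel.w c) (boxArgs K) ⊆ Tr → Tr ⊆ trueIn (Countermodel.w c) (boxArgs K) ++ Other →
      Agrees (Canon Rule Tr) (Countermodel.w c) (boxArgs K)
    sideAgrees {K = K} c ih {Other} {Tr} bK bOther disjoint noBadOther own⊆Tr Tr⊆ =
      canonicalAgrees (λ F∈ e → own⊆Tr (trueIn-∈ w F∈ e)) closedTr
      where
      open Countermodel c
      S = boxArgs K
      closedTr : ∀ {T F} → T ⊆ Tr → F ∈ S → Rule T F → w F ≡ true
      closedTr T⊆ F∈ r with splitRule ih (λ x∈ → bK (F∷own⊆S x∈)) bOther (λ a∈ → disjoint (F∷own⊆S a∈)) (λ x∈ → Tr⊆ (T⊆ x∈)) r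
        where F∷own⊆S = ∈-∷⁺ʳ F∈ (trueIn-⊆ w S)
      ... | inj₁ (T' , T'⊆ , r') = closed T'⊆ F∈ r'
      ... | inj₂ (T' , T'⊆ , b') = ⊥-elim (noBadOther T'⊆ b')

    ⇒b-false : ∀ a → a ⇒b false ≡ false → a ≡ true
    ⇒b-false true _ = refl

    -- Gluing: countermodels of ¬A and of B, with A and B sharing no
    -- variable, yield a model of X refuting A ⊃ B.  Its boxes are read
    -- canonically over the union of their true box arguments, its variables
    -- are taken from the countermodel of ¬A on A and from that of B elsewhere.
    glue : ∀ {k} → HalldenBelow k → ∀ {A B} → Bounded k (boxArgs (¬' A)) → Bounded k (boxArgs B) →
      NoSharedVar A B → Countermodel (¬' A) → Countermodel B → ¬ Th (A ⊃ B)
    glue ih {A} {B} bA bB noShared cA cB d = true≢false (trans (sym B-true) MB.refutes)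
      where
      module MA = Countermodel cA
      module MB = Countermodel cB
      SA = boxArgs (¬' A)
      SB = boxArgs B
      TrA = trueIn MA.w SA
      TrB = trueIn MB.w SB
      disjoint : Disjoint SA SB
      disjoint a∈ b∈ oa ob = noShared (_ , ¬-occurs (boxArgs-occurs (¬' A) a∈ oa) , boxArgs-occurs B b∈ ob)
      noBad : NoBad (TrA ++ TrB)
      noBad T⊆ b with splitBad ih (λ x∈ → bA (trueIn-⊆ MA.w SA x∈)) (λ x∈ → bB (trueIn-⊆ MB.w SB x∈))
                                 (λ a∈ b∈ → disjoint (trueIn-⊆ MA.w SA a∈) (trueIn-⊆ MB.w SB b∈)) T⊆ b
      ... | inj₁ (T' , T'⊆ , b') = MA.noBad T'⊆ b'
      ... | inj₂ (T' , T'⊆ , b') = MB.noBad T'⊆ b'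
      W = Canon Rule (TrA ++ TrB)
      agreeA : Agrees W MA.w SA
      agreeA = sideAgrees cA ih bA (λ x∈ → bB (trueIn-⊆ MB.w SB x∈))
        (λ a∈ b∈ → disjoint a∈ (trueIn-⊆ MB.w SB b∈)) MB.noBad (xs⊆xs++ys TrA TrB) (λ x∈ → x∈)
      agreeB : Agrees W MB.w SB
      agreeB = sideAgrees cB ih bB (λ x∈ → bA (trueIn-⊆ MA.w SA x∈))
        (λ b∈ a∈ ob oa → disjoint (trueIn-⊆ MA.w SA a∈) b∈ oa ob) MA.noBad (xs⊆ys++xs TrB TrA) swap
        where
        swap : TrA ++ TrB ⊆ TrB ++ TrA
        swap x∈ = [ ∈-++⁺ʳ TrB , ∈-++⁺ˡ ]′ (∈-++⁻ TrA x∈)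
      v : ℕ → Bool
      v n with occurs? n A
      ... | yes _ = MA.v n
      ... | no _ = MB.v n
      v-onA : ∀ n → Occurs n A → v n ≡ MA.v n
      v-onA n o with occurs? n A
      ... | yes _ = refl
      ... | no ¬o = ⊥-elim (¬o o)
      v-onB : ∀ n → Occurs n B → v n ≡ MB.v n
      v-onB n o with occurs? n A
      ... | yes o' = ⊥-elim (noShared (n , o' , o))
      ... | no _ = refl
      A-sat : Sat v W A
      A-sat = proj₂ (Sat⇔eval v (Canon-stable Rule _) A (λ F∈ → agreeA (∈-++⁺ˡ F∈)))
        (trans (eval-vars v MA.v MA.w A v-onA) (⇒b-false _ MA.refutes))
      B-true : eval MB.v MB.w B ≡ true
      B-true = trans (sym (eval-vars v MB.v MB.w B v-onB))
        (proj₁ (Sat⇔eval v (Canon-stable Rule _) B agreeB) (canonicalSound noBad d v A-sat))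

    halldenStep : ∀ {k} → Oracle k → HalldenBelow k → ∀ A B →
      Bounded k (boxArgs (¬' A)) → Bounded k (boxArgs B) → Th (A ⊃ B) → NoSharedVar A B → Th (¬' A) ⊎ Th B
    halldenStep o ih A B bA bB d noShared with decideStep o (¬' A) bA | decideStep o B bB
    ... | inj₁ ¬A | _ = inj₁ ¬A
    ... | inj₂ _ | inj₁ b = inj₂ b
    ... | inj₂ cA | inj₂ cB = ⊥-elim (glue ih bA bB noShared cA cB d)

    hallden : ∀ k → HalldenBelow k
    hallden zero P Q ()
    hallden (suc m) P Q (s≤s P≤m) (s≤s Q≤m) =
      halldenStep (oracle m) (hallden m) P Q (boxArgs-bounded (¬' P) (⊔-lub P≤m z≤n)) (boxArgs-bounded Q Q≤m)

    halldenTheorem : ∀ A B → Th (A ⊃ B) → NoSharedVar A B → Th (¬' A) ⊎ Th B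
    halldenTheorem A B = hallden (suc (depth A ⊔ depth B)) A B (s≤s (m≤m⊔n _ _)) (s≤s (m≤n⊔m _ _))

single⊆ : ∀ {x : Fm} {L} → x ∈ L → [ x ] ⊆ L
single⊆ x∈ = ∈-∷⁺ʳ x∈ (λ ())

pair⊆ : ∀ {x y : Fm} {L} → x ∈ L → y ∈ L → (x ∷ y ∷ []) ⊆ L
pair⊆ x∈ y∈ = ∈-∷⁺ʳ x∈ (single⊆ y∈)

decide-× : ∀ {P Q : Set} (P? : Dec P) b → (b ≡ true → Q) × (Q → b ≡ true) →
  (does P? ∧ b ≡ true → P × Q) × (P × Q → does P? ∧ b ≡ true)
decide-× (yes p) b (f , g) = (λ e → p , f e) , (λ (_ , q) → g q)
decide-× (no ¬p) b _ = (λ ()) , (λ (p , _) → ⊥-elim (¬p p))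

¬-depth : ∀ {k} t → depth t < k → depth (¬' t) < k
¬-depth t t<k@(s≤s _) = ⊔-lub t<k (s≤s z≤n)

-- The four logics without C.  Their rules have at most one premise: in the
-- congruential logics □t entails □Y when t ↔ Y is a theorem, in the
-- monotone ones when t ⊃ Y is.
data Kind : Set where
  congruential monotone : Kind

step : Kind → Fm → Fm → Fm
step congruential t Y = t ↔ Y
step monotone t Y = t ⊃ Y

-- the condition under which D◇ refutes □t ∧ □t'
clash : Kind → Fm → Fm → Fm
clash congruential t t' = t' ↔ ¬' t
clash monotone t t' = t ⊃ ¬' t'

step-depth : ∀ κ {k t Y} → depth t < k → depth Y < k → depth (step κ t Y) < k
step-depth congruential t<k Y<k = ⊔-lub (⊔-lub t<k Y<k) (⊔-lub Y<k t<k)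
step-depth monotone t<k Y<k = ⊔-lub t<k Y<k

clash-depth : ∀ κ {k t t'} → depth t < k → depth t' < k → depth (clash κ t t') < k
clash-depth congruential {t = t} t<k t'<k = ⊔-lub (⊔-lub t'<k (¬-depth t t<k)) (⊔-lub (¬-depth t t<k) t'<k)
clash-depth monotone {t' = t'} t<k t'<k = ⊔-lub t<k (¬-depth t' t'<k)

record SingletonLogic (X : XD) (κ : Kind) : Set where
  field
    hasN : Has X N
    hasD : Has X Dbot
    hasM : κ ≡ monotone → Has X M
    dia? : Dec (Has X Ddia)
    axioms : ∀ {S} → Has X S → (S ≡ N) ⊎ (S ≡ Dbot) ⊎ (S ≡ Ddia) ⊎ (S ≡ M × κ ≡ monotone)

module StepFacts (X : XD) where
  open Reasoning X

  step-refl : ∀ κ t → Th (step κ t t)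
  step-refl congruential t = by₀ (p₀ ↔ p₀) refl (t ∷ [])
  step-refl monotone t = by₀ (p₀ ⊃ p₀) refl (t ∷ [])

  step-resp : ∀ κ {t A B} → Th (step κ t A) → Th (A ↔ B) → Th (step κ t B)
  step-resp congruential {t} {A} {B} = by₂ (p₀ ↔ p₁) (p₁ ↔ p₂) (p₀ ↔ p₂) refl (t ∷ A ∷ B ∷ [])
  step-resp monotone {t} {A} {B} = by₂ (p₀ ⊃ p₁) (p₁ ↔ p₂) (p₀ ⊃ p₂) refl (t ∷ A ∷ B ∷ [])

  step-imp : ∀ κ {t Y} → Th (step κ t Y) → Th (t ⊃ Y)
  step-imp congruential {t} {Y} = by₁ (p₀ ↔ p₁) (p₀ ⊃ p₁) refl (t ∷ Y ∷ [])
  step-imp monotone r = r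

  step-sound : ∀ κ → (κ ≡ monotone → Has X M) → ∀ {t Y} → Th (step κ t Y) → Th (□ t ⊃ □ Y)
  step-sound congruential _ {t} {Y} r = by₁ (p₀ ↔ p₁) (p₀ ⊃ p₁) refl (□ t ∷ □ Y ∷ []) (re r)
  step-sound monotone hM r = □-mono (hM refl) r

  clash-excl : ∀ κ {t t'} → Th (clash κ t t') → Th (¬' (t ∧' t'))
  clash-excl congruential {t} {t'} = by₁ (p₁ ↔ ¬' p₀) (¬' (p₀ ∧' p₁)) refl (t ∷ t' ∷ [])
  clash-excl monotone {t} {t'} = by₁ (p₀ ⊃ ¬' p₁) (¬' (p₀ ∧' p₁)) refl (t ∷ t' ∷ [])

  clash-intro : ∀ κ {t t' A} → Th (step κ t A) → Th (step κ t' (¬' A)) → Th (clash κ t t')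
  clash-intro congruential {t} {t'} {A} = by₂ (p₀ ↔ p₂) (p₁ ↔ ¬' p₂) (p₁ ↔ ¬' p₀) refl (t ∷ t' ∷ A ∷ [])
  clash-intro monotone {t} {t'} {A} = by₂ (p₀ ⊃ p₂) (p₁ ⊃ ¬' p₂) (p₀ ⊃ ¬' p₁) refl (t ∷ t' ∷ A ∷ [])

  clash-sound : ∀ κ → (κ ≡ monotone → Has X M) → Has X Ddia → ∀ {t t'} → Th (clash κ t t') →
    Th (¬' (⋀□ (t ∷ t' ∷ [])))
  clash-sound congruential _ hDia {t} {t'} r =
    by₂ (p₁ ↔ p₂) (p₀ ⊃ ¬' p₂) (¬' (p₀ ∧' (p₁ ∧' ⊤'))) refl (□ t ∷ □ t' ∷ □ (¬' t) ∷ [])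
      (re r) (ax hDia (instDdia t))
  clash-sound monotone hM hDia {t} {t'} r =
    by₂ (p₀ ⊃ p₂) (p₁ ⊃ ¬' p₂) (¬' (p₀ ∧' (p₁ ∧' ⊤'))) refl (□ t ∷ □ t' ∷ □ (¬' t') ∷ [])
      (□-mono (hM refl) r) (ax hDia (instDdia t'))

module Singleton {X : XD} {κ : Kind} (L : SingletonLogic X κ) where
  open Reasoning X
  open Soundness X
  open Framework X
  open StepFacts X
  open SingletonLogic L

  Rule : List Fm → Fm → Set
  Rule [] Y = Th Y
  Rule (t ∷ []) Y = Th (step κ t Y)
  Rule (_ ∷ _ ∷ _) _ = ⊥

  Bad : List Fm → Set
  Bad [] = ⊥
  Bad (t ∷ []) = Th (¬' t)
  Bad (t ∷ t' ∷ []) = Has X Ddia × Th (clash κ t t')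
  Bad (_ ∷ _ ∷ _ ∷ _) = ⊥

  ruleSound : ∀ {T Y} → Rule T Y → Th (⋀□ T ⊃ □ Y)
  ruleSound {[]} {Y} r = by₁ p₀ (⊤' ⊃ p₀) refl (□ Y ∷ []) (□-necessitation hasN r)
  ruleSound {t ∷ []} {Y} r = by₁ (p₀ ⊃ p₁) ((p₀ ∧' ⊤') ⊃ p₁) refl (□ t ∷ □ Y ∷ []) (step-sound κ hasM r)

  badSound : ∀ {T} → Bad T → Th (¬' (⋀□ T))
  badSound {t ∷ []} b = by₁ (¬' p₀) (¬' (p₀ ∧' ⊤')) refl (□ t ∷ []) (□-refutation hasD b)
  badSound {t ∷ t' ∷ []} (hDia , c) = clash-sound κ hasM hDia c

  ruleB : (Fm → Bool) → List Fm → Fm → Bool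
  ruleB O [] Y = O Y
  ruleB O (t ∷ []) Y = O (step κ t Y)
  ruleB O (_ ∷ _ ∷ _) _ = false

  ruleB-correct : ∀ {k} (o : Oracle k) {T Y} → Bounded k (Y ∷ T) →
    (ruleB (Oracle.answer o) T Y ≡ true → Rule T Y) × (Rule T Y → ruleB (Oracle.answer o) T Y ≡ true)
  ruleB-correct o {[]} b = Oracle.correct o (b (here refl))
  ruleB-correct o {t ∷ []} b = Oracle.correct o (step-depth κ (b (there (here refl))) (b (here refl)))
  ruleB-correct o {_ ∷ _ ∷ _} b = (λ ()) , (λ ())

  badB : (Fm → Bool) → List Fm → Bool
  badB O [] = false
  badB O (t ∷ []) = O (¬' t)
  badB O (t ∷ t' ∷ []) = does dia? ∧ O (clash κ t t')
  badB O (_ ∷ _ ∷ _ ∷ _) = false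

  badB-correct : ∀ {k} (o : Oracle k) {T} → Bounded k T →
    (badB (Oracle.answer o) T ≡ true → Bad T) × (Bad T → badB (Oracle.answer o) T ≡ true)
  badB-correct o {[]} b = (λ ()) , (λ ())
  badB-correct o {t ∷ []} b = Oracle.correct o (¬-depth t (b (here refl)))
  badB-correct o {t ∷ t' ∷ []} b =
    decide-× dia? _ (Oracle.correct o (clash-depth κ (b (here refl)) (b (there (here refl)))))
  badB-correct o {_ ∷ _ ∷ _ ∷ _} b = (λ ()) , (λ ())

  cands : List Fm → List (List Fm)
  cands S = [] ∷ map [_] S ++ cartesianProductWith (λ t t' → t ∷ t' ∷ []) S S

  cands-⊆ : ∀ S {T} → T ∈ cands S → T ⊆ S
  cands-⊆ S (here refl) ()
  cands-⊆ S (there T∈) with ∈-++⁻ (map [_] S) T∈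
  ... | inj₁ T∈₁ with ∈-map⁻ [_] T∈₁
  ... | t , t∈ , refl = single⊆ t∈
  cands-⊆ S (there T∈) | inj₂ T∈₂ with ∈-cartesianProductWith⁻ _ S S T∈₂
  ... | t , t' , t∈ , t'∈ , refl = pair⊆ t∈ t'∈

  single∈cands : ∀ {S t} → t ∈ S → [ t ] ∈ cands S
  single∈cands t∈ = there (∈-++⁺ˡ (∈-map⁺ [_] t∈))

  coverRule : ∀ {S Tr T Y} → Tr ⊆ S → T ⊆ Tr → Rule T Y → ∃[ T' ] (T' ∈ cands S × T' ⊆ Tr × Rule T' Y)
  coverRule {T = []} Tr⊆S T⊆ r = [] , here refl , T⊆ , r
  coverRule {T = t ∷ []} Tr⊆S T⊆ r = [ t ] , single∈cands (Tr⊆S (T⊆ (here refl))) , T⊆ , r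

  coverBad : ∀ {S Tr T} → Tr ⊆ S → T ⊆ Tr → Bad T → ∃[ T' ] (T' ∈ cands S × T' ⊆ Tr × Bad T')
  coverBad {T = t ∷ []} Tr⊆S T⊆ b = [ t ] , single∈cands (Tr⊆S (T⊆ (here refl))) , T⊆ , b
  coverBad {S} {T = t ∷ t' ∷ []} Tr⊆S T⊆ b =
    _ , there (∈-++⁺ʳ (map [_] S) (∈-cartesianProductWith⁺ _ (Tr⊆S (T⊆ (here refl))) (Tr⊆S (T⊆ (there (here refl)))))) , T⊆ , b

  module Canonical (Tr : List Fm) (noBad : ∀ {T} → T ⊆ Tr → ¬ Bad T) where
    W = Canon Rule Tr

    ruleResp : ∀ T {A B} → Th (A ↔ B) → Rule T A → Rule T B
    ruleResp [] e r = ↔-mp r e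
    ruleResp (t ∷ []) e r = step-resp κ r e

    -- D⊥: a rule for ⊥ makes ⊥ a theorem or refutes its premise
    noBox⊥ : ¬ W ⊥'
    noBox⊥ c = c λ { ([] , _ , r) → consistent r ; (t ∷ [] , T⊆ , r) → noBad T⊆ (step-imp κ r) }

    -- D◇: rules for A and for ¬A give a theorem ⊥, a refuted premise or a clash
    noBoxContradiction : Has X Ddia → ∀ A → W A → W (¬' A) → ⊥
    noBoxContradiction hDia A cA c¬A = cA λ (T₁ , T₁⊆ , r₁) → c¬A λ (T₂ , T₂⊆ , r₂) → contradiction T₁ T₂ T₁⊆ T₂⊆ r₁ r₂
      where
      contradiction : ∀ T₁ T₂ → T₁ ⊆ Tr → T₂ ⊆ Tr → Rule T₁ A → Rule T₂ (¬' A) → ⊥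
      contradiction [] [] _ _ r₁ r₂ = consistent (mp r₂ r₁)
      contradiction [] (t' ∷ []) _ T₂⊆ r₁ r₂ =
        noBad T₂⊆ (by₂ p₁ (p₀ ⊃ ¬' p₁) (¬' p₀) refl (t' ∷ A ∷ []) r₁ (step-imp κ r₂))
      contradiction (t ∷ []) [] T₁⊆ _ r₁ r₂ =
        noBad T₁⊆ (by₂ (p₀ ⊃ p₁) (¬' p₁) (¬' p₀) refl (t ∷ A ∷ []) (step-imp κ r₁) r₂)
      contradiction (t ∷ []) (t' ∷ []) T₁⊆ T₂⊆ r₁ r₂ =
        noBad (pair⊆ (T₁⊆ (here refl)) (T₂⊆ (here refl))) (hDia , clash-intro κ r₁ r₂)

    ruleSplit : κ ≡ monotone → ∀ T {A B} → Rule T (A ∧' B) → Rule T A × Rule T B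
    ruleSplit _ [] {A} {B} r =
      by₁ (p₀ ∧' p₁) p₀ refl (A ∷ B ∷ []) r , by₁ (p₀ ∧' p₁) p₁ refl (A ∷ B ∷ []) r
    ruleSplit refl (t ∷ []) {A} {B} r =
      by₁ (p₀ ⊃ (p₁ ∧' p₂)) (p₀ ⊃ p₁) refl (t ∷ A ∷ B ∷ []) r , by₁ (p₀ ⊃ (p₁ ∧' p₂)) (p₀ ⊃ p₂) refl (t ∷ A ∷ B ∷ []) r

    validAxiom : ∀ {S A} → Has X S → Inst S A → ∀ v → Sat v W A
    validAxiom h i v with axioms h
    validAxiom h instN v | inj₁ refl = λ k → k ([] , (λ ()) , ⊤-thm)
    validAxiom h instDbot v | inj₂ (inj₁ refl) = noBox⊥
    validAxiom h (instDdia A) v | inj₂ (inj₂ (inj₁ refl)) = noBoxContradiction h A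
    validAxiom h (instM A B) v | inj₂ (inj₂ (inj₂ (refl , mono))) = λ c →
      (λ k → c λ (T , T⊆ , r) → k (T , T⊆ , proj₁ (ruleSplit mono T r))) ,
      (λ k → c λ (T , T⊆ , r) → k (T , T⊆ , proj₂ (ruleSplit mono T r)))

    validates : Validates W
    validates = record
      { congruence = λ e c k → c λ (T , T⊆ , r) → k (T , T⊆ , ruleResp T e r)
      ; axioms = validAxiom }

  -- A rule with its premise in TB either is replaced by the empty rule or
  -- refutes the premise, by Halldén applied to premise ⊃ conclusion.
  splitRule : ∀ {k} → HalldenBelow k → ∀ {TA TB Y T} → Bounded k (Y ∷ TA) → Bounded k TB →
    Disjoint (Y ∷ TA) TB → T ⊆ TA ++ TB → Rule T Y →
    (∃[ T' ] (T' ⊆ TA × Rule T' Y)) ⊎ (∃[ T' ] (T' ⊆ TB × Bad T'))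
  splitRule ih {T = []} _ _ _ _ r = inj₁ ([] , (λ ()) , r)
  splitRule ih {TA} {TB} {Y} {t ∷ []} bA bB dj T⊆ r with ∈-++⁻ TA (T⊆ (here refl))
  ... | inj₁ t∈A = inj₁ ([ t ] , single⊆ t∈A , r)
  ... | inj₂ t∈B with ih t Y (bB t∈B) (bA (here refl)) (step-imp κ r) (λ (_ , ot , oY) → dj (here refl) t∈B oY ot)
  ... | inj₁ ¬t = inj₂ ([ t ] , single⊆ t∈B , ¬t)
  ... | inj₂ y = inj₁ ([] , (λ ()) , y)

  -- A clashing pair split between TA and TB refutes one of its members, by
  -- Halldén applied to t' ⊃ ¬t.
  splitBad : ∀ {k} → HalldenBelow k → ∀ {TA TB T} → Bounded k TA → Bounded k TB →
    Disjoint TA TB → T ⊆ TA ++ TB → Bad T →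
    (∃[ T' ] (T' ⊆ TA × Bad T')) ⊎ (∃[ T' ] (T' ⊆ TB × Bad T'))
  splitBad ih {TA} {T = t ∷ []} bA bB dj T⊆ b with ∈-++⁻ TA (T⊆ (here refl))
  ... | inj₁ t∈A = inj₁ ([ t ] , single⊆ t∈A , b)
  ... | inj₂ t∈B = inj₂ ([ t ] , single⊆ t∈B , b)
  splitBad ih {TA} {T = t ∷ t' ∷ []} bA bB dj T⊆ (hDia , c)
    with ∈-++⁻ TA (T⊆ (here refl)) | ∈-++⁻ TA (T⊆ (there (here refl)))
  ... | inj₁ t∈A | inj₁ t'∈A = inj₁ (_ , pair⊆ t∈A t'∈A , hDia , c)
  ... | inj₂ t∈B | inj₂ t'∈B = inj₂ (_ , pair⊆ t∈B t'∈B , hDia , c)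
  ... | inj₁ t∈A | inj₂ t'∈B
    with ih t' (¬' t) (bB t'∈B) (¬-depth t (bA t∈A))
            (by₁ (¬' (p₀ ∧' p₁)) (p₁ ⊃ ¬' p₀) refl (t ∷ t' ∷ []) (clash-excl κ c))
            (λ (_ , o' , o) → dj t∈A t'∈B (¬-occurs o) o')
  ... | inj₁ ¬t' = inj₂ ([ t' ] , single⊆ t'∈B , ¬t')
  ... | inj₂ ¬t = inj₁ ([ t ] , single⊆ t∈A , ¬t)
  splitBad ih {TA} {T = t ∷ t' ∷ []} bA bB dj T⊆ (hDia , c) | inj₂ t∈B | inj₁ t'∈A
    with ih t (¬' t') (bB t∈B) (¬-depth t' (bA t'∈A))
            (by₁ (¬' (p₀ ∧' p₁)) (p₀ ⊃ ¬' p₁) refl (t ∷ t' ∷ []) (clash-excl κ c))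
            (λ (_ , o , o') → dj t'∈A t∈B (¬-occurs o') o)
  ... | inj₁ ¬t = inj₂ ([ t ] , single⊆ t∈B , ¬t)
  ... | inj₂ ¬t' = inj₁ ([ t' ] , single⊆ t'∈A , ¬t')

  system : RuleSystem
  system = record
    { Rule = Rule ; Bad = Bad ; ruleSound = ruleSound ; badSound = badSound ; ruleRefl = step-refl κ
    ; ruleB = ruleB ; ruleB-correct = ruleB-correct ; badB = badB ; badB-correct = badB-correct
    ; cands = cands ; cands-⊆ = cands-⊆ ; coverRule = coverRule ; coverBad = coverBad
    ; canonical = Canonical.validates ; splitRule = splitRule ; splitBad = splitBad }

END-logic : SingletonLogic END congruential
END-logic = record { hasN = h1N ; hasD = h1D ; hasM = λ () ; dia? = no λ ()
  ; axioms = λ { h1N → inj₁ refl ; h1D → inj₂ (inj₁ refl) } }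

END◇-logic : SingletonLogic END◇ congruential
END◇-logic = record { hasN = h2N ; hasD = h2D ; hasM = λ () ; dia? = yes h2◇
  ; axioms = λ { h2N → inj₁ refl ; h2D → inj₂ (inj₁ refl) ; h2◇ → inj₂ (inj₂ (inj₁ refl)) } }

EMND-logic : SingletonLogic EMND monotone
EMND-logic = record { hasN = h3N ; hasD = h3D ; hasM = λ _ → h3M ; dia? = no λ ()
  ; axioms = λ { h3N → inj₁ refl ; h3D → inj₂ (inj₁ refl) ; h3M → inj₂ (inj₂ (inj₂ (refl , refl))) } }

EMND◇-logic : SingletonLogic EMND◇ monotone
EMND◇-logic = record { hasN = h4N ; hasD = h4D ; hasM = λ _ → h4M ; dia? = yes h4◇
  ; axioms = λ { h4N → inj₁ refl ; h4D → inj₂ (inj₁ refl) ; h4◇ → inj₂ (inj₂ (inj₁ refl))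
               ; h4M → inj₂ (inj₂ (inj₂ (refl , refl))) } }

⋀-occurs : ∀ {n} L → Occurs n (⋀ L) → ∃[ x ] (x ∈ L × Occurs n x)
⋀-occurs [] (o⊃l ())
⋀-occurs [] (o⊃r ())
⋀-occurs (x ∷ L) (o∧l o) = x , here refl , o
⋀-occurs (x ∷ L) (o∧r o) = let (y , y∈ , o') = ⋀-occurs L o in y , there y∈ , o'

⋀-depth : ∀ {k} L → 0 < k → Bounded k L → depth (⋀ L) < k
⋀-depth [] 0<k b = 0<k
⋀-depth (x ∷ L) 0<k b = ⊔-lub (b (here refl)) (⋀-depth L 0<k (b ∘ there))

positive : ∀ {n k} → n < k → 0 < k
positive (s≤s _) = s≤s z≤n

taut-⊃ : ∀ P Q → (∀ v w → eval v w P ≡ true → eval v w Q ≡ true) → Taut (P ⊃ Q)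
taut-⊃ P Q f v w with eval v w P in eq
... | true = f v w eq
... | false = refl

⋀-weaken : ∀ {T T'} → T ⊆ T' → Taut (⋀ T' ⊃ ⋀ T)
⋀-weaken {T} {T'} T⊆ = taut-⊃ (⋀ T') (⋀ T) λ v w e → ⋀-true v w T λ x∈ → ⋀-member v w T' e (T⊆ x∈)

⋀-split : ∀ {T T₁ T₂} → (∀ {x} → x ∈ T → x ∈ T₁ ⊎ x ∈ T₂) → Taut ((⋀ T₁ ∧' ⋀ T₂) ⊃ ⋀ T)
⋀-split {T} {T₁} {T₂} cover = taut-⊃ (⋀ T₁ ∧' ⋀ T₂) (⋀ T) λ v w e → ⋀-true v w T λ x∈ →
  [ ⋀-member v w T₁ (∧-trueˡ e) , ⋀-member v w T₂ (∧-trueʳ (eval v w (⋀ T₁)) e) ]′ (cover x∈)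

sublists : List Fm → List (List Fm)
sublists [] = [ [] ]
sublists (x ∷ S) = map (x ∷_) (sublists S) ++ sublists S

sublists-⊆ : ∀ S {T} → T ∈ sublists S → T ⊆ S
sublists-⊆ [] (here refl) ()
sublists-⊆ (x ∷ S) T∈ with ∈-++⁻ (map (x ∷_) (sublists S)) T∈
... | inj₂ T∈S = λ t∈ → there (sublists-⊆ S T∈S t∈)
... | inj₁ T∈xS with ∈-map⁻ (x ∷_) T∈xS
... | T' , T'∈ , refl = ∈-∷⁺ʳ (here refl) (λ t∈ → there (sublists-⊆ S T'∈ t∈))

filter∈sublists : ∀ {P : Fm → Set} (P? : Decidable P) S → filter P? S ∈ sublists S
filter∈sublists P? [] = here refl
filter∈sublists P? (x ∷ S) with does (P? x)
... | true = ∈-++⁺ˡ (∈-map⁺ (x ∷_) (filter∈sublists P? S))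
... | false = ∈-++⁺ʳ (map (x ∷_) (sublists S)) (filter∈sublists P? S)

module Conjunctive where
  X = EMCND◇
  open Reasoning X
  open Soundness X
  open Framework X

  Rule : List Fm → Fm → Set
  Rule T Y = Th (⋀ T ⊃ Y)

  Bad : List Fm → Set
  Bad T = Th (¬' (⋀ T))

  box-⋀ : ∀ T → Th (⋀□ T ⊃ □ (⋀ T))
  box-⋀ [] = by₁ p₀ (⊤' ⊃ p₀) refl (□ ⊤' ∷ []) (ax h5N instN)
  box-⋀ (t ∷ T) = by₂ (p₁ ⊃ p₂) ((p₀ ∧' p₂) ⊃ p₃) ((p₀ ∧' p₁) ⊃ p₃) refl
    (□ t ∷ ⋀□ T ∷ □ (⋀ T) ∷ □ (t ∧' ⋀ T) ∷ []) (box-⋀ T) (ax h5C (instC t (⋀ T)))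

  ruleSound : ∀ {T Y} → Rule T Y → Th (⋀□ T ⊃ □ Y)
  ruleSound {T} r = ⊃-trans (box-⋀ T) (□-mono h5M r)

  badSound : ∀ {T} → Bad T → Th (¬' (⋀□ T))
  badSound {T} b = ⊃-trans (box-⋀ T) (□-refutation h5D b)

  ruleRefl : ∀ t → Rule [ t ] t
  ruleRefl t = by₀ ((p₀ ∧' ⊤') ⊃ p₀) refl (t ∷ [])

  weaken : ∀ {T T' Y} → T ⊆ T' → Rule T Y → Rule T' Y
  weaken T⊆ r = ⊃-trans (taut (⋀-weaken T⊆)) r

  ruleB : (Fm → Bool) → List Fm → Fm → Bool
  ruleB O T Y = O (⋀ T ⊃ Y)

  ruleB-correct : ∀ {k} (o : Oracle k) {T Y} → Bounded k (Y ∷ T) →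
    (ruleB (Oracle.answer o) T Y ≡ true → Rule T Y) × (Rule T Y → ruleB (Oracle.answer o) T Y ≡ true)
  ruleB-correct o {T} b = Oracle.correct o (⊔-lub (⋀-depth T (positive (b (here refl))) (b ∘ there)) (b (here refl)))

  -- the empty conjunction ⊤ is never refuted, which keeps its depth out of the test
  badB : (Fm → Bool) → List Fm → Bool
  badB O [] = false
  badB O T@(_ ∷ _) = O (¬' (⋀ T))

  badB-correct : ∀ {k} (o : Oracle k) {T} → Bounded k T →
    (badB (Oracle.answer o) T ≡ true → Bad T) × (Bad T → badB (Oracle.answer o) T ≡ true)
  badB-correct o {[]} b = (λ ()) , (λ ¬⊤ → ⊥-elim (consistent (mp ¬⊤ ⊤-thm)))
  badB-correct o {T@(_ ∷ _)} b = Oracle.correct o (¬-depth (⋀ T) (⋀-depth T (positive (b (here refl))) b))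

  -- every premise set inside Tr ⊆ S can be replaced by the sublist of S lying in Tr
  inside : List Fm → List Fm → List Fm
  inside Tr = filter (_∈? Tr)

  inside-⊆ : ∀ {Tr} S → inside Tr S ⊆ Tr
  inside-⊆ {Tr} S x∈ = proj₂ (∈-filter⁻ (_∈? Tr) {xs = S} x∈)

  inside-⊇ : ∀ {S Tr T} → Tr ⊆ S → T ⊆ Tr → T ⊆ inside Tr S
  inside-⊇ {Tr = Tr} Tr⊆S T⊆ x∈ = ∈-filter⁺ (_∈? Tr) (Tr⊆S (T⊆ x∈)) (T⊆ x∈)

  coverRule : ∀ {S Tr T Y} → Tr ⊆ S → T ⊆ Tr → Rule T Y → ∃[ T' ] (T' ∈ sublists S × T' ⊆ Tr × Rule T' Y)
  coverRule {S} Tr⊆S T⊆ r = inside _ S , filter∈sublists _ S , inside-⊆ S , weaken (inside-⊇ Tr⊆S T⊆) r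

  coverBad : ∀ {S Tr T} → Tr ⊆ S → T ⊆ Tr → Bad T → ∃[ T' ] (T' ∈ sublists S × T' ⊆ Tr × Bad T')
  coverBad {S} Tr⊆S T⊆ b = inside _ S , filter∈sublists _ S , inside-⊆ S , weaken (inside-⊇ Tr⊆S T⊆) b

  -- The canonical interpretation over a set without bad subsets validates X;
  -- for C and D◇ two rules are merged into one with the union of premises.
  canonical : ∀ Tr → (∀ {T} → T ⊆ Tr → ¬ Bad T) → Validates (Canon Rule Tr)
  canonical Tr noBad = record { congruence = congruence ; axioms = validAxiom }
    where
    W = Canon Rule Tr
    congruence : ∀ {A B} → Th (A ↔ B) → W A → W B
    congruence {A} {B} e c k = c λ (T , T⊆ , r) →
      k (T , T⊆ , by₂ (p₀ ⊃ p₁) (p₁ ↔ p₂) (p₀ ⊃ p₂) refl (⋀ T ∷ A ∷ B ∷ []) r e)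
    merge : ∀ {A B} → W A → W B → ¬ ¬ (∃[ T ] (T ⊆ Tr × Rule T A × Rule T B))
    merge cA cB k = cA λ (T₁ , T₁⊆ , r₁) → cB λ (T₂ , T₂⊆ , r₂) →
      k (T₁ ++ T₂ , (λ x∈ → [ T₁⊆ , T₂⊆ ]′ (∈-++⁻ T₁ x∈)) ,
         weaken (xs⊆xs++ys T₁ T₂) r₁ , weaken (xs⊆ys++xs T₂ T₁) r₂)
    validAxiom : ∀ {S A} → Has X S → Inst S A → ∀ v → Sat v W A
    validAxiom h5M (instM A B) v c =
      (λ k → c λ (T , T⊆ , r) → k (T , T⊆ , by₁ (p₀ ⊃ (p₁ ∧' p₂)) (p₀ ⊃ p₁) refl (⋀ T ∷ A ∷ B ∷ []) r)) ,
      (λ k → c λ (T , T⊆ , r) → k (T , T⊆ , by₁ (p₀ ⊃ (p₁ ∧' p₂)) (p₀ ⊃ p₂) refl (⋀ T ∷ A ∷ B ∷ []) r))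
    validAxiom h5C (instC A B) v (cA , cB) k = merge cA cB λ (T , T⊆ , r₁ , r₂) →
      k (T , T⊆ , by₂ (p₀ ⊃ p₁) (p₀ ⊃ p₂) (p₀ ⊃ (p₁ ∧' p₂)) refl (⋀ T ∷ A ∷ B ∷ []) r₁ r₂)
    validAxiom h5N instN v k = k ([] , (λ ()) , by₀ (⊤' ⊃ ⊤') refl [])
    validAxiom h5D instDbot v c = c λ (T , T⊆ , r) → noBad T⊆ r
    validAxiom h5◇ (instDdia A) v cA c¬A = merge cA c¬A λ (T , T⊆ , r₁ , r₂) →
      noBad T⊆ (by₂ (p₀ ⊃ p₁) (p₀ ⊃ ¬' p₁) (¬' p₀) refl (⋀ T ∷ A ∷ []) r₁ r₂)

  module Partition {TA TB T : List Fm} (T⊆ : T ⊆ TA ++ TB) where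
    TAp = filter (_∈? TA) T
    TBp = filter (_∉? TA) T

    TAp⊆ : TAp ⊆ TA
    TAp⊆ x∈ = proj₂ (∈-filter⁻ (_∈? TA) {xs = T} x∈)

    TBp⊆ : TBp ⊆ TB
    TBp⊆ x∈ with ∈-filter⁻ (_∉? TA) {xs = T} x∈
    ... | x∈T , x∉TA = [ (λ x∈TA → ⊥-elim (x∉TA x∈TA)) , (λ x∈TB → x∈TB) ]′ (∈-++⁻ TA (T⊆ x∈T))

    regroup : ∀ {Y} → Th (⋀ T ⊃ Y) → Th (⋀ TBp ⊃ (⋀ TAp ⊃ Y))
    regroup {Y} r = by₂ ((p₀ ∧' p₁) ⊃ p₂) (p₂ ⊃ p₃) (p₀ ⊃ (p₁ ⊃ p₃)) refl (⋀ TBp ∷ ⋀ TAp ∷ ⋀ T ∷ Y ∷ [])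
      (taut (⋀-split cover)) r
      where
      cover : ∀ {x} → x ∈ T → x ∈ TBp ⊎ x ∈ TAp
      cover {x} x∈ with x ∈? TA
      ... | yes x∈TA = inj₂ (∈-filter⁺ (_∈? TA) x∈ x∈TA)
      ... | no x∉TA = inj₁ (∈-filter⁺ (_∉? TA) x∈ x∉TA)

    separate : ∀ {k} → HalldenBelow k → 0 < k → Bounded k TB → ∀ {Q} → depth Q < k →
      (∀ {n b} → b ∈ TB → Occurs n b → Occurs n Q → ⊥) → Th (⋀ TBp ⊃ Q) → Th Q ⊎ Bad TBp
    separate ih 0<k bB {Q} Q<k dj d =
      [ inj₂ , inj₁ ]′ (ih (⋀ TBp) Q (⋀-depth TBp 0<k (λ x∈ → bB (TBp⊆ x∈))) Q<k d noShared)
      where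
      noShared : NoSharedVar (⋀ TBp) Q
      noShared (_ , oB , oQ) = let (b , b∈ , ob) = ⋀-occurs TBp oB in dj (TBp⊆ b∈) ob oQ

  -- A rule from premises in TA ++ TB: Halldén for ⋀(T ∖ TA) ⊃ (⋀(T ∩ TA) ⊃ Y).
  splitRule : ∀ {k} → HalldenBelow k → ∀ {TA TB Y T} → Bounded k (Y ∷ TA) → Bounded k TB →
    Disjoint (Y ∷ TA) TB → T ⊆ TA ++ TB → Rule T Y →
    (∃[ T' ] (T' ⊆ TA × Rule T' Y)) ⊎ (∃[ T' ] (T' ⊆ TB × Bad T'))
  splitRule ih {TA} {TB} {Y} bYA bB dj T⊆ r =
    ⊎-map (λ q → TAp , TAp⊆ , q) (λ b → TBp , TBp⊆ , b) (separate ih 0<k bB Q<k noShared (regroup r))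
    where
    open Partition {TA} {TB} T⊆
    0<k = positive (bYA (here refl))
    Q<k = ⊔-lub (⋀-depth TAp 0<k (λ x∈ → bYA (there (TAp⊆ x∈)))) (bYA (here refl))
    noShared : ∀ {n b} → b ∈ TB → Occurs n b → Occurs n (⋀ TAp ⊃ Y) → ⊥
    noShared b∈ ob (o⊃l oA) = let (a , a∈ , oa) = ⋀-occurs TAp oA in dj (there (TAp⊆ a∈)) b∈ oa ob
    noShared b∈ ob (o⊃r oY) = dj (here refl) b∈ oY ob

  -- A bad set in TA ++ TB: Halldén for ⋀(T ∖ TA) ⊃ ¬⋀(T ∩ TA).
  splitBad : ∀ {k} → HalldenBelow k → ∀ {TA TB T} → Bounded k TA → Bounded k TB →
    Disjoint TA TB → T ⊆ TA ++ TB → Bad T →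
    (∃[ T' ] (T' ⊆ TA × Bad T')) ⊎ (∃[ T' ] (T' ⊆ TB × Bad T'))
  splitBad ih {T = []} _ _ _ _ ¬⊤ = ⊥-elim (consistent (mp ¬⊤ ⊤-thm))
  splitBad ih {TA} {TB} {T@(t ∷ _)} bA bB dj T⊆ b =
    ⊎-map (λ q → TAp , TAp⊆ , q) (λ b → TBp , TBp⊆ , b) (separate ih 0<k bB Q<k noShared (regroup b))
    where
    open Partition {TA} {TB} T⊆
    0<k = positive ([ bA , bB ]′ (∈-++⁻ TA (T⊆ (here refl))))
    Q<k = ¬-depth (⋀ TAp) (⋀-depth TAp 0<k (λ x∈ → bA (TAp⊆ x∈)))
    noShared : ∀ {n b} → b ∈ TB → Occurs n b → Occurs n (¬' (⋀ TAp)) → ⊥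
    noShared b∈ ob oQ = let (a , a∈ , oa) = ⋀-occurs TAp (¬-occurs oQ) in dj (TAp⊆ a∈) b∈ oa ob

  system : RuleSystem
  system = record
    { Rule = Rule ; Bad = Bad ; ruleSound = λ {T} → ruleSound {T} ; badSound = λ {T} → badSound {T}
    ; ruleRefl = ruleRefl ; ruleB = ruleB ; ruleB-correct = ruleB-correct ; badB = badB ; badB-correct = badB-correct
    ; cands = sublists ; cands-⊆ = sublists-⊆ ; coverRule = coverRule ; coverBad = coverBad
    ; canonical = canonical ; splitRule = splitRule ; splitBad = splitBad }

corollary2 : (X : XD) (A B : Fm) → X ⊢ (A ⊃ B) → NoSharedVar A B →
    (X ⊢ ¬' A) ⊎ (X ⊢ B)
corollary2 END = Framework.Completeness.halldenTheorem END (Singleton.system END-logic)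
corollary2 END◇ = Framework.Completeness.halldenTheorem END◇ (Singleton.system END◇-logic)
corollary2 EMND = Framework.Completeness.halldenTheorem EMND (Singleton.system EMND-logic)
corollary2 EMND◇ = Framework.Completeness.halldenTheorem EMND◇ (Singleton.system EMND◇-logic)
corollary2 EMCND◇ = Framework.Completeness.halldenTheorem EMCND◇ Conjunctive.system
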